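{- Let $D$ be an orientation of an $n$-vertex simple graph $G$. If every matching in the complement of $G$ has size at most $m$, then the multiplicity of $-1$ as a root of $A_D(t)$ is at least $\lfloor n/2\rfloor-m$.
   Context: For an $n$-vertex digraph $D$, a descent of a bijection $\sigma:V(D)\to[n]$ is an arc $u\to v$ with $\sigma(u)>\sigma(v)$, $\mathrm{des}_D(\sigma)$ is the number of descents, and $A_D(t)=\sum_\sigma t^{\mathrm{des}_D(\sigma)}$ over all such bijections. An orientation of $G$ is a digraph obtained by directing each edge of $G$ in one direction. -}

module Defs where

open import Data.Nat using (ℕ; zero; suc; _<ᵇ_; _≤_)
open import Data.Fin using (Fin; toℕ; _≟_)
open import Data.Fin.Properties using ()
open import Data.Bool using (Bool; true; false; _∧_; if_then_else_)
open import Data.List using (List; []; _∷_; map; concatMap; allFin; length; foldr; _++_)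
open import Data.Nat.ListAction using (sum)
open import Data.List.Relation.Unary.All using (All)
open import Data.List.Relation.Unary.Unique.Propositional using (Unique)
open import Data.Vec using (Vec; lookup) renaming ([] to []ᵥ; _∷_ to _∷ᵥ_)
open import Data.Integer using (ℤ; +_) renaming (_+_ to _+ℤ_; _*_ to _*ℤ_)
open import Data.Product using (_×_; _,_; proj₁; proj₂; Σ)
open import Data.Sum using (_⊎_)
open import Relation.Nullary using (¬_; does)
open import Relation.Binary.PropositionalEquality using (_≡_)

Rel : ℕ → Set
Rel n = Fin n → Fin n → Bool

record IsSimpleGraph {n : ℕ} (G : Rel n) : Set where
  field
    irrefl : ∀ u → G u u ≡ false
    sym    : ∀ u v → G u v ≡ G v u

-- D (arc relation: D u v ≡ true means an arc u → v) is an orientation of G: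
-- every arc comes from an edge, and every edge is directed in exactly one way.
record IsOrientation {n : ℕ} (G : Rel n) (D : Rel n) : Set where
  field
    arc⇒edge   : ∀ u v → D u v ≡ true → G u v ≡ true
    edge⇒arc   : ∀ u v → G u v ≡ true → D u v ≡ true ⊎ D v u ≡ true
    antisym    : ∀ u v → D u v ≡ true → ¬ (D v u ≡ true)

endpoints : {n : ℕ} → List (Fin n × Fin n) → List (Fin n)
endpoints [] = []
endpoints ((u , v) ∷ M) = u ∷ v ∷ endpoints M

record IsComplementMatching {n : ℕ} (G : Rel n) (M : List (Fin n × Fin n)) : Set where
  field
    nonEdge  : All (λ e → ¬ (proj₁ e ≡ proj₂ e) × G (proj₁ e) (proj₂ e) ≡ false) M
    disjoint : Unique (endpoints M)

-- Bijections V(D) = Fin n → [n], enumerated as vectors (σ(0),…,σ(n-1)).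

allVecs : (n k : ℕ) → List (Vec (Fin n) k)
allVecs n zero = []ᵥ ∷ []
allVecs n (suc k) = concatMap (λ i → map (i ∷ᵥ_) (allVecs n k)) (allFin n)

andAll : {A : Set} → (A → Bool) → List A → Bool
andAll p = foldr (λ a b → p a ∧ b) true

isInjective : {n : ℕ} → Vec (Fin n) n → Bool
isInjective {n} σ =
  andAll (λ i → andAll (λ j →
    if does (lookup σ i ≟ lookup σ j) then does (i ≟ j) else true) (allFin n)) (allFin n)

filterᵇ : {A : Set} → (A → Bool) → List A → List A
filterᵇ p [] = []
filterᵇ p (a ∷ as) = if p a then a ∷ filterᵇ p as else filterᵇ p as

bijections : (n : ℕ) → List (Vec (Fin n) n)
bijections n = filterᵇ isInjective (allVecs n n)

count : {A : Set} → (A → Bool) → List A → ℕ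
count p [] = 0
count p (a ∷ as) = if p a then suc (count p as) else count p as

des : {n : ℕ} → Rel n → Vec (Fin n) n → ℕ
des {n} D σ =
  sum (map (λ u → count (λ v → D u v ∧ (toℕ (lookup σ v) <ᵇ toℕ (lookup σ u))) (allFin n))
           (allFin n))

-- Polynomials over ℤ as coefficient lists (constant term first).

Poly : Set
Poly = List ℤ

coeff : Poly → ℕ → ℤ
coeff [] i = + 0
coeff (a ∷ p) zero = a
coeff (a ∷ p) (suc i) = coeff p i

_+ₚ_ : Poly → Poly → Poly
[] +ₚ q = q
(a ∷ p) +ₚ [] = a ∷ p
(a ∷ p) +ₚ (b ∷ q) = (a +ℤ b) ∷ (p +ₚ q)

_*ₚ_ : Poly → Poly → Poly
[] *ₚ q = []
(a ∷ p) *ₚ q = map (a *ℤ_) q +ₚ (+ 0 ∷ (p *ₚ q))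

_^ₚ_ : Poly → ℕ → Poly
p ^ₚ zero = + 1 ∷ []
p ^ₚ suc k = p *ₚ (p ^ₚ k)

tPlusOne : Poly
tPlusOne = + 1 ∷ + 1 ∷ []

-- Coefficient of t^k in A_D(t) is #{σ bijection : des_D(σ) = k}.
-- des ≤ n², so the list of coefficients up to degree n² is complete.
A : {n : ℕ} → Rel n → Poly
A {n} D = map (λ k → + count (λ σ → does (des D σ Data.Nat.≟ k)) (bijections n))
              (Data.List.upTo (suc (n Data.Nat.* n)))

-- p divides q in ℤ[t] (equality of polynomials = equality of all coefficients).
_∣ₚ_ : Poly → Poly → Set
p ∣ₚ q = Σ Poly (λ r → ∀ i → coeff q i ≡ coeff (p *ₚ r) i)

RootMinusOneMultAtLeast : Poly → ℕ → Set
RootMinusOneMultAtLeast P k = (tPlusOne ^ₚ k) ∣ₚ P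

module Submission where

-- Pair the labels as {2p, 2p + 1}. Exchanging the labels 2j and 2j + 1 is an involution on
-- labellings which changes des only through an arc between the two vertices carrying them.
-- Summing over all bijections, each labelling with a falling arc 2j + 1 → 2j therefore merges
-- with its partner, which has the rising arc 2j → 2j + 1, into t^d (1 + t). Doing this for the
-- first k = ⌊n/2⌋ pairs gives A_D(t) = Σ t^(des σ) (1 + t)^(r σ), over the bijections σ with
-- no falling pair among the first k, where r σ counts their rising pairs. Every other pair is a
-- non-edge of G, since D orients all edges, and these pairs are disjoint: they form a matching
-- of the complement. Hence k ∸ r σ ≤ m, and (1 + t)^(k ∸ m) divides every summand.

open import Defs

open import Data.Bool using (Bool; true; false; _∧_; if_then_else_; T)
open import Data.Bool.Properties using (T-≡; ∧-identityʳ)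
open import Data.Nat as ℕ using (ℕ; zero; suc; _+_; _*_; _∸_; _/_; _≤_; _<_; _≡ᵇ_; _<ᵇ_; z≤n; s≤s)
open import Data.Nat.Properties
open import Data.Nat.DivMod using (m/n*n≤m)
open import Data.Nat.ListAction using (sum)
open import Data.Nat.ListAction.Properties using (sum-++)
open import Data.Integer using (ℤ; +_) renaming (_+_ to _+ℤ_; _*_ to _*ℤ_)
import Data.Integer.Properties as ℤ
open import Data.Fin as Fin using (Fin; zero; suc; toℕ)
import Data.Fin.Properties as Fin
open import Data.Fin.Permutation using (Permutation′; _⟨$⟩ʳ_; permutation)
open import Data.Vec as Vec using (Vec) renaming ([] to []ᵥ; _∷_ to _∷ᵥ_)
import Data.Vec.Properties as Vec
open import Data.List as List using (List; []; _∷_; _++_; allFin; concatMap; length)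
import Data.List.Properties as List
open import Data.List.Membership.Propositional using (_∈_)
open import Data.List.Membership.Propositional.Properties using (∈-allFin)
open import Data.List.Relation.Unary.Any using (here; there)
open import Data.List.Relation.Unary.All as All using (All; []; _∷_)
open import Data.List.Relation.Unary.AllPairs using ([]; _∷_)
open import Data.Product using (_×_; _,_; proj₁; proj₂; ∃; ∃₂)
open import Data.Sum using (inj₁; inj₂)
open import Function using (_∘_; id)
open import Function.Bundles using (Equivalence)
open import Function.Definitions using (Injective)
open import Relation.Binary.PropositionalEquality
open import Relation.Nullary using (¬_; Dec; yes; no; does; contradiction)
open import Relation.Nullary.Decidable using (dec-true; dec-false)
open import Algebra.Properties.CommutativeMonoid.Sum +-0-commutativeMonoid
  using (sum-cong-≗; ∑-distrib-+; ∑-permute; sum-replicate-zero; sum-syntax)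
open import Algebra.Properties.CommutativeSemigroup ℤ.+-commutativeSemigroup using (interchange)

∧-≡true : ∀ {x y} → x ∧ y ≡ true → x ≡ true × y ≡ true
∧-≡true {true} {true} _ = refl , refl

indicator : Bool → ℕ
indicator b = if b then 1 else 0

indicator≤1 : ∀ b → indicator b ≤ 1
indicator≤1 true  = ≤-refl
indicator≤1 false = z≤n

indicator≢0⇒≡true : ∀ {b} → indicator b ≢ 0 → b ≡ true
indicator≢0⇒≡true {true}  _   = refl
indicator≢0⇒≡true {false} b≢0 = contradiction refl b≢0

indicator-∧ : ∀ b c → indicator (b ∧ c) ≡ (if b then indicator c else 0)
indicator-∧ true  c = refl
indicator-∧ false c = refl

if-0 : ∀ b → (if b then 0 else 0) ≡ 0
if-0 true  = refl
if-0 false = refl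

double-< : ∀ {p j} → p < j → suc (p + p) < j + j
double-< {p} {j} p<j = subst (_≤ j + j) (cong suc (+-suc p p)) (+-mono-≤ p<j p<j)

≡ᵇ-sound : ∀ {m n} → (m ≡ᵇ n) ≡ true → m ≡ n
≡ᵇ-sound {m} {n} = ≡ᵇ⇒≡ m n ∘ Equivalence.from T-≡

≡ᵇ-complete : ∀ {m n} → m ≡ n → (m ≡ᵇ n) ≡ true
≡ᵇ-complete {m} {n} = Equivalence.to T-≡ ∘ ≡⇒≡ᵇ m n

≢⇒≡ᵇ≡false : ∀ {m n} → m ≢ n → (m ≡ᵇ n) ≡ false
≢⇒≡ᵇ≡false {m} {n} m≢n with m ≡ᵇ n in eq
... | false = refl
... | true  = contradiction (≡ᵇ-sound eq) m≢n

-- Finite sums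

module _ {n : ℕ} where

  ∑-zero : {f : Fin n → ℕ} → (∀ i → f i ≡ 0) → ∑[ i < n ] f i ≡ 0
  ∑-zero f≡0 = trans (sum-cong-≗ f≡0) (sum-replicate-zero n)

  ∑-+-cong : {f g f′ g′ : Fin n → ℕ} → (∀ i → f i + g i ≡ f′ i + g′ i) →
             ∑[ i < n ] f i + ∑[ i < n ] g i ≡ ∑[ i < n ] f′ i + ∑[ i < n ] g′ i
  ∑-+-cong {f} {g} {f′} {g′} e =
    trans (sym (∑-distrib-+ f g)) (trans (sum-cong-≗ e) (∑-distrib-+ f′ g′))

∑-≤ : ∀ {n c} (f : Fin n → ℕ) → (∀ i → f i ≤ c) → ∑[ i < n ] f i ≤ n * c
∑-≤ {zero}  f f≤c = z≤n
∑-≤ {suc n} f f≤c = +-mono-≤ (f≤c zero) (∑-≤ (f ∘ suc) (f≤c ∘ suc))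

≤-∑ : ∀ {n} (f : Fin n → ℕ) i → f i ≤ ∑[ j < n ] f j
≤-∑ f zero    = m≤m+n _ _
≤-∑ f (suc i) = ≤-trans (≤-∑ (f ∘ suc) i) (m≤n+m _ _)

∑≢0⇒∃≢0 : ∀ {n} (f : Fin n → ℕ) → ∑[ i < n ] f i ≢ 0 → ∃ λ i → f i ≢ 0
∑≢0⇒∃≢0 {zero}  f ∑≢0 = contradiction refl ∑≢0
∑≢0⇒∃≢0 {suc n} f ∑≢0 with f zero ℕ.≟ 0
... | no f₀≢0 = zero , f₀≢0
... | yes f₀≡0 =
  let i , fᵢ≢0 = ∑≢0⇒∃≢0 (f ∘ suc) (∑≢0 ∘ cong₂ _+_ f₀≡0)
  in suc i , fᵢ≢0

∑-≤1 : ∀ {n} (f : Fin n → ℕ) → (∀ i → f i ≤ 1) →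
       (∀ i j → f i ≢ 0 → f j ≢ 0 → i ≡ j) → ∑[ i < n ] f i ≤ 1
∑-≤1 {zero}  f f≤1 unique = z≤n
∑-≤1 {suc n} f f≤1 unique with f zero ℕ.≟ 0
... | yes f₀≡0 rewrite f₀≡0 =
  ∑-≤1 (f ∘ suc) (f≤1 ∘ suc) λ i j fᵢ≢0 fⱼ≢0 →
    Fin.suc-injective (unique (suc i) (suc j) fᵢ≢0 fⱼ≢0)
... | no f₀≢0 = subst (λ x → f zero + x ≤ 1) (sym (∑-zero rest≡0))
  (subst (_≤ 1) (sym (+-identityʳ _)) (f≤1 zero))
  where
  rest≡0 : ∀ i → f (suc i) ≡ 0
  rest≡0 i with f (suc i) ℕ.≟ 0
  ... | yes fᵢ≡0 = fᵢ≡0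
  ... | no fᵢ≢0 = contradiction (unique zero (suc i) f₀≢0 fᵢ≢0) λ ()

module _ {n : ℕ} where

  countPairs : (Fin n → Fin n → Bool) → ℕ
  countPairs b = ∑[ u < n ] ∑[ v < n ] indicator (b u v)

  countPairs-cong : ∀ {b b′} → (∀ u v → b u v ≡ b′ u v) → countPairs b ≡ countPairs b′
  countPairs-cong e = sum-cong-≗ λ u → sum-cong-≗ λ v → cong indicator (e u v)

  countPairs-+-cong : ∀ {b c b′ c′} →
    (∀ u v → indicator (b u v) + indicator (c u v) ≡ indicator (b′ u v) + indicator (c′ u v)) →
    countPairs b + countPairs c ≡ countPairs b′ + countPairs c′
  countPairs-+-cong e = ∑-+-cong λ u → ∑-+-cong (e u)

  countPairs-≤ : ∀ b → countPairs b ≤ n * n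
  countPairs-≤ b = subst (countPairs b ≤_) (cong (n *_) (*-identityʳ n))
    (∑-≤ _ λ u → ∑-≤ _ λ v → indicator≤1 (b u v))

  countPairs≢0⇒∃ : ∀ b → countPairs b ≢ 0 → ∃₂ λ u v → b u v ≡ true
  countPairs≢0⇒∃ b ≢0 =
    let u , rowᵤ≢0 = ∑≢0⇒∃≢0 (λ u → ∑[ v < n ] indicator (b u v)) ≢0
        v , bᵤᵥ≢0  = ∑≢0⇒∃≢0 (λ v → indicator (b u v)) rowᵤ≢0
    in u , v , indicator≢0⇒≡true bᵤᵥ≢0

  countPairs≡0⇒≡false : ∀ b → countPairs b ≡ 0 → ∀ u v → b u v ≡ false
  countPairs≡0⇒≡false b ≡0 u v with b u v in buv
  ... | false = refl
  ... | true  = contradiction (subst (1 ≤_) ≡0 1≤count) λ ()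
    where
    1≤count : 1 ≤ countPairs b
    1≤count = ≤-trans (subst (λ x → 1 ≤ indicator x) (sym buv) ≤-refl)
                (≤-trans (≤-∑ (λ v → indicator (b u v)) v) (≤-∑ (λ u → ∑[ v < n ] indicator (b u v)) u))

  countPairs-≤1 : ∀ b → (∀ {u v u′ v′} → b u v ≡ true → b u′ v′ ≡ true → u ≡ u′ × v ≡ v′) →
                  countPairs b ≤ 1
  countPairs-≤1 b unique = ∑-≤1 _ row≤1 λ u u′ rowᵤ≢0 rowᵤ′≢0 →
    let v  , buv≢0   = ∑≢0⇒∃≢0 (λ v → indicator (b u v)) rowᵤ≢0
        v′ , bu′v′≢0 = ∑≢0⇒∃≢0 (λ v → indicator (b u′ v)) rowᵤ′≢0
    in proj₁ (unique (indicator≢0⇒≡true buv≢0) (indicator≢0⇒≡true bu′v′≢0))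
    where
    row≤1 : ∀ u → ∑[ v < n ] indicator (b u v) ≤ 1
    row≤1 u = ∑-≤1 _ (λ v → indicator≤1 (b u v)) λ v v′ buv≢0 buv′≢0 →
      proj₂ (unique (indicator≢0⇒≡true buv≢0) (indicator≢0⇒≡true buv′≢0))

module _ {n : ℕ} where

  sumVecs : ∀ k → (Vec (Fin n) k → ℕ) → ℕ
  sumVecs zero    g = g []ᵥ
  sumVecs (suc k) g = ∑[ i < n ] sumVecs k (g ∘ (i ∷ᵥ_))

  sumVecs-cong : ∀ k {g h : Vec (Fin n) k → ℕ} → (∀ σ → g σ ≡ h σ) → sumVecs k g ≡ sumVecs k h
  sumVecs-cong zero    e = e []ᵥ
  sumVecs-cong (suc k) e = sum-cong-≗ λ i → sumVecs-cong k (e ∘ (i ∷ᵥ_))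

  sumVecs-distrib-+ : ∀ k (g h : Vec (Fin n) k → ℕ) →
                      sumVecs k (λ σ → g σ + h σ) ≡ sumVecs k g + sumVecs k h
  sumVecs-distrib-+ zero    g h = refl
  sumVecs-distrib-+ (suc k) g h =
    trans (sum-cong-≗ λ i → sumVecs-distrib-+ k (g ∘ (i ∷ᵥ_)) (h ∘ (i ∷ᵥ_)))
          (∑-distrib-+ (λ i → sumVecs k (g ∘ (i ∷ᵥ_))) (λ i → sumVecs k (h ∘ (i ∷ᵥ_))))

  sumVecs-permute : ∀ k (π : Permutation′ n) (g : Vec (Fin n) k → ℕ) →
                    sumVecs k (g ∘ Vec.map (π ⟨$⟩ʳ_)) ≡ sumVecs k g
  sumVecs-permute zero    π g = refl
  sumVecs-permute (suc k) π g =
    trans (sum-cong-≗ λ i → sumVecs-permute k π (g ∘ ((π ⟨$⟩ʳ i) ∷ᵥ_)))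
          (sym (∑-permute (λ i → sumVecs k (g ∘ (i ∷ᵥ_))) π))

sum-tabulate : ∀ {n} (f : Fin n → ℕ) → sum (List.tabulate f) ≡ ∑[ i < n ] f i
sum-tabulate {zero}  f = refl
sum-tabulate {suc n} f = cong (_+_ (f zero)) (sum-tabulate (f ∘ suc))

sum-map-allFin : ∀ {n} (f : Fin n → ℕ) → sum (List.map f (allFin n)) ≡ ∑[ i < n ] f i
sum-map-allFin f = trans (cong sum (List.map-tabulate id f)) (sum-tabulate f)

count≡sum : ∀ {A : Set} (p : A → Bool) xs → count p xs ≡ sum (List.map (indicator ∘ p) xs)
count≡sum p []       = refl
count≡sum p (x ∷ xs) with p x
... | true  = cong suc (count≡sum p xs)
... | false = count≡sum p xs

count-none : ∀ {A : Set} (p : A → Bool) xs → (∀ x → p x ≡ false) → count p xs ≡ 0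
count-none p []       none = refl
count-none p (x ∷ xs) none rewrite none x = count-none p xs none

count-filterᵇ : ∀ {A : Set} (p q : A → Bool) xs → count p (filterᵇ q xs) ≡ count (λ x → q x ∧ p x) xs
count-filterᵇ p q []       = refl
count-filterᵇ p q (x ∷ xs) with q x
... | false = count-filterᵇ p q xs
... | true with p x
...   | true  = cong suc (count-filterᵇ p q xs)
...   | false = count-filterᵇ p q xs

sum-map-concatMap : ∀ {A B : Set} (g : B → ℕ) (f : A → List B) xs →
  sum (List.map g (concatMap f xs)) ≡ sum (List.map (λ x → sum (List.map g (f x))) xs)
sum-map-concatMap g f []       = refl
sum-map-concatMap g f (x ∷ xs) = begin
  sum (List.map g (f x ++ concatMap f xs))                 ≡⟨ cong sum (List.map-++ g (f x) _) ⟩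
  sum (List.map g (f x) ++ List.map g (concatMap f xs))    ≡⟨ sum-++ (List.map g (f x)) _ ⟩
  sum (List.map g (f x)) + sum (List.map g (concatMap f xs)) ≡⟨ cong (_+_ _) (sum-map-concatMap g f xs) ⟩
  sum (List.map g (f x)) + sum (List.map (λ x → sum (List.map g (f x))) xs) ∎
  where open ≡-Reasoning

sum-map-allVecs : ∀ {n} k (g : Vec (Fin n) k → ℕ) → sum (List.map g (allVecs n k)) ≡ sumVecs k g
sum-map-allVecs         zero    g = +-identityʳ (g []ᵥ)
sum-map-allVecs {n = n} (suc k) g = begin
  sum (List.map g (concatMap (λ i → List.map (i ∷ᵥ_) (allVecs n k)) (allFin n)))
    ≡⟨ sum-map-concatMap g _ (allFin n) ⟩
  sum (List.map (λ i → sum (List.map g (List.map (i ∷ᵥ_) (allVecs n k)))) (allFin n))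
    ≡⟨ cong sum (List.map-cong row (allFin n)) ⟩
  sum (List.map (λ i → sumVecs k (g ∘ (i ∷ᵥ_))) (allFin n))
    ≡⟨ sum-map-allFin (λ i → sumVecs k (g ∘ (i ∷ᵥ_))) ⟩
  sumVecs (suc k) g ∎
  where
  open ≡-Reasoning
  row : ∀ i → sum (List.map g (List.map (i ∷ᵥ_) (allVecs n k))) ≡ sumVecs k (g ∘ (i ∷ᵥ_))
  row i = trans (cong sum (sym (List.map-∘ (allVecs n k)))) (sum-map-allVecs k (g ∘ (i ∷ᵥ_)))

-- Polynomial coefficients

coeff-+ₚ : ∀ p q i → coeff (p +ₚ q) i ≡ coeff p i +ℤ coeff q i
coeff-+ₚ []      q       i       = sym (ℤ.+-identityˡ _)
coeff-+ₚ (a ∷ p) []      i       = sym (ℤ.+-identityʳ _)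
coeff-+ₚ (a ∷ p) (b ∷ q) zero    = refl
coeff-+ₚ (a ∷ p) (b ∷ q) (suc i) = coeff-+ₚ p q i

coeff-map-* : ∀ a q i → coeff (List.map (a *ℤ_) q) i ≡ a *ℤ coeff q i
coeff-map-* a []      i       = sym (ℤ.*-zeroʳ a)
coeff-map-* a (b ∷ q) zero    = refl
coeff-map-* a (b ∷ q) (suc i) = coeff-map-* a q i

coeff-∷-cong : ∀ a {p q} → (∀ i → coeff p i ≡ coeff q i) → ∀ i → coeff (a ∷ p) i ≡ coeff (a ∷ q) i
coeff-∷-cong a p≈q zero    = refl
coeff-∷-cong a p≈q (suc i) = p≈q i

coeff-∷-*ₚ : ∀ a p q i → coeff ((a ∷ p) *ₚ q) i ≡ a *ℤ coeff q i +ℤ coeff (+ 0 ∷ (p *ₚ q)) i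
coeff-∷-*ₚ a p q i = trans (coeff-+ₚ (List.map (a *ℤ_) q) _ i) (cong (_+ℤ _) (coeff-map-* a q i))

coeff-*ₚ-[] : ∀ p i → coeff (p *ₚ []) i ≡ + 0
coeff-*ₚ-[] []      i       = refl
coeff-*ₚ-[] (a ∷ p) zero    = refl
coeff-*ₚ-[] (a ∷ p) (suc i) = coeff-*ₚ-[] p i

coeff-[0] : ∀ i → coeff (+ 0 ∷ []) i ≡ + 0
coeff-[0] zero    = refl
coeff-[0] (suc i) = refl

coeff-[0]-*ₚ : ∀ q i → coeff ((+ 0 ∷ []) *ₚ q) i ≡ + 0
coeff-[0]-*ₚ q i = trans (coeff-∷-*ₚ (+ 0) [] q i) (trans (ℤ.+-identityˡ _) (coeff-[0] i))

coeff-[1]-*ₚ : ∀ q i → coeff ((+ 1 ∷ []) *ₚ q) i ≡ coeff q i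
coeff-[1]-*ₚ q i = begin
  coeff ((+ 1 ∷ []) *ₚ q) i             ≡⟨ coeff-∷-*ₚ (+ 1) [] q i ⟩
  + 1 *ℤ coeff q i +ℤ coeff (+ 0 ∷ []) i ≡⟨ cong₂ _+ℤ_ (ℤ.*-identityˡ (coeff q i)) (coeff-[0] i) ⟩
  coeff q i +ℤ + 0                      ≡⟨ ℤ.+-identityʳ _ ⟩
  coeff q i                             ∎
  where open ≡-Reasoning

coeff-*ₚ-+ₚ : ∀ p q r i → coeff (p *ₚ (q +ₚ r)) i ≡ coeff (p *ₚ q) i +ℤ coeff (p *ₚ r) i
coeff-*ₚ-+ₚ []      q r i = refl
coeff-*ₚ-+ₚ (a ∷ p) q r i = begin
  coeff ((a ∷ p) *ₚ (q +ₚ r)) i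
    ≡⟨ coeff-∷-*ₚ a p (q +ₚ r) i ⟩
  a *ℤ coeff (q +ₚ r) i +ℤ coeff (+ 0 ∷ (p *ₚ (q +ₚ r))) i
    ≡⟨ cong₂ _+ℤ_ (trans (cong (a *ℤ_) (coeff-+ₚ q r i)) (ℤ.*-distribˡ-+ a _ _))
                  (trans (coeff-∷-cong (+ 0) shifted i) (coeff-+ₚ (+ 0 ∷ (p *ₚ q)) (+ 0 ∷ (p *ₚ r)) i)) ⟩
  (a *ℤ coeff q i +ℤ a *ℤ coeff r i) +ℤ (coeff (+ 0 ∷ (p *ₚ q)) i +ℤ coeff (+ 0 ∷ (p *ₚ r)) i)
    ≡⟨ interchange (a *ℤ coeff q i) (a *ℤ coeff r i) (coeff (+ 0 ∷ (p *ₚ q)) i)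
                   (coeff (+ 0 ∷ (p *ₚ r)) i) ⟩
  (a *ℤ coeff q i +ℤ coeff (+ 0 ∷ (p *ₚ q)) i) +ℤ (a *ℤ coeff r i +ℤ coeff (+ 0 ∷ (p *ₚ r)) i)
    ≡⟨ sym (cong₂ _+ℤ_ (coeff-∷-*ₚ a p q i) (coeff-∷-*ₚ a p r i)) ⟩
  coeff ((a ∷ p) *ₚ q) i +ℤ coeff ((a ∷ p) *ₚ r) i ∎
  where
  open ≡-Reasoning
  shifted : ∀ j → coeff (p *ₚ (q +ₚ r)) j ≡ coeff ((p *ₚ q) +ₚ (p *ₚ r)) j
  shifted j = trans (coeff-*ₚ-+ₚ p q r j) (sym (coeff-+ₚ (p *ₚ q) (p *ₚ r) j))

coeff-+ₚ-*ₚ : ∀ p p′ q i → coeff ((p +ₚ p′) *ₚ q) i ≡ coeff (p *ₚ q) i +ℤ coeff (p′ *ₚ q) i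
coeff-+ₚ-*ₚ []      p′       q i = sym (ℤ.+-identityˡ _)
coeff-+ₚ-*ₚ (a ∷ p) []       q i = sym (ℤ.+-identityʳ _)
coeff-+ₚ-*ₚ (a ∷ p) (b ∷ p′) q i = begin
  coeff (((a +ℤ b) ∷ (p +ₚ p′)) *ₚ q) i
    ≡⟨ coeff-∷-*ₚ (a +ℤ b) (p +ₚ p′) q i ⟩
  (a +ℤ b) *ℤ coeff q i +ℤ coeff (+ 0 ∷ ((p +ₚ p′) *ₚ q)) i
    ≡⟨ cong₂ _+ℤ_ (ℤ.*-distribʳ-+ (coeff q i) a b)
                  (trans (coeff-∷-cong (+ 0) shifted i) (coeff-+ₚ (+ 0 ∷ (p *ₚ q)) (+ 0 ∷ (p′ *ₚ q)) i)) ⟩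
  (a *ℤ coeff q i +ℤ b *ℤ coeff q i) +ℤ (coeff (+ 0 ∷ (p *ₚ q)) i +ℤ coeff (+ 0 ∷ (p′ *ₚ q)) i)
    ≡⟨ interchange (a *ℤ coeff q i) (b *ℤ coeff q i) (coeff (+ 0 ∷ (p *ₚ q)) i)
                   (coeff (+ 0 ∷ (p′ *ₚ q)) i) ⟩
  (a *ℤ coeff q i +ℤ coeff (+ 0 ∷ (p *ₚ q)) i) +ℤ (b *ℤ coeff q i +ℤ coeff (+ 0 ∷ (p′ *ₚ q)) i)
    ≡⟨ sym (cong₂ _+ℤ_ (coeff-∷-*ₚ a p q i) (coeff-∷-*ₚ b p′ q i)) ⟩
  coeff ((a ∷ p) *ₚ q) i +ℤ coeff ((b ∷ p′) *ₚ q) i ∎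
  where
  open ≡-Reasoning
  shifted : ∀ j → coeff ((p +ₚ p′) *ₚ q) j ≡ coeff ((p *ₚ q) +ₚ (p′ *ₚ q)) j
  shifted j = trans (coeff-+ₚ-*ₚ p p′ q j) (sym (coeff-+ₚ (p *ₚ q) (p′ *ₚ q) j))

coeff-tPlusOne-*ₚ-*ₚ : ∀ p q i →
  coeff ((tPlusOne *ₚ p) *ₚ q) i ≡ coeff (p *ₚ q) i +ℤ coeff (+ 0 ∷ (p *ₚ q)) i
coeff-tPlusOne-*ₚ-*ₚ p q i = begin
  coeff ((tPlusOne *ₚ p) *ₚ q) i
    ≡⟨ cong (λ p₁ → coeff ((p₁ +ₚ (+ 0 ∷ (p₁ +ₚ (+ 0 ∷ [])))) *ₚ q) i) map-1* ⟩
  coeff ((p +ₚ (+ 0 ∷ (p +ₚ (+ 0 ∷ [])))) *ₚ q) i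
    ≡⟨ coeff-+ₚ-*ₚ p _ q i ⟩
  coeff (p *ₚ q) i +ℤ coeff ((+ 0 ∷ (p +ₚ (+ 0 ∷ []))) *ₚ q) i
    ≡⟨ cong (coeff (p *ₚ q) i +ℤ_) (trans (coeff-∷-*ₚ (+ 0) (p +ₚ (+ 0 ∷ [])) q i) (ℤ.+-identityˡ _)) ⟩
  coeff (p *ₚ q) i +ℤ coeff (+ 0 ∷ ((p +ₚ (+ 0 ∷ [])) *ₚ q)) i
    ≡⟨ cong (coeff (p *ₚ q) i +ℤ_) (coeff-∷-cong (+ 0) p+0≈p i) ⟩
  coeff (p *ₚ q) i +ℤ coeff (+ 0 ∷ (p *ₚ q)) i ∎
  where
  open ≡-Reasoning
  map-1* : List.map (+ 1 *ℤ_) p ≡ p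
  map-1* = trans (List.map-cong ℤ.*-identityˡ p) (List.map-id p)
  p+0≈p : ∀ j → coeff ((p +ₚ (+ 0 ∷ [])) *ₚ q) j ≡ coeff (p *ₚ q) j
  p+0≈p j = trans (coeff-+ₚ-*ₚ p (+ 0 ∷ []) q j)
                  (trans (cong (coeff (p *ₚ q) j +ℤ_) (coeff-[0]-*ₚ q j)) (ℤ.+-identityʳ _))

-- The coefficient of tⁱ in tᵈ (1 + t)ᵃ.
shiftedBinomial : ℕ → ℕ → ℕ → ℕ
shiftedBinomial d zero    i       = indicator (d ≡ᵇ i)
shiftedBinomial d (suc a) zero    = shiftedBinomial d a zero
shiftedBinomial d (suc a) (suc i) = shiftedBinomial d a (suc i) + shiftedBinomial d a i

shiftedBinomial-suc-zero : ∀ d a → shiftedBinomial (suc d) a zero ≡ 0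
shiftedBinomial-suc-zero d zero    = refl
shiftedBinomial-suc-zero d (suc a) = shiftedBinomial-suc-zero d a

shiftedBinomial-suc-suc : ∀ d a i → shiftedBinomial (suc d) a (suc i) ≡ shiftedBinomial d a i
shiftedBinomial-suc-suc d zero    i       = refl
shiftedBinomial-suc-suc d (suc a) zero    =
  trans (cong₂ _+_ (shiftedBinomial-suc-suc d a zero) (shiftedBinomial-suc-zero d a)) (+-identityʳ _)
shiftedBinomial-suc-suc d (suc a) (suc i) =
  cong₂ _+_ (shiftedBinomial-suc-suc d a (suc i)) (shiftedBinomial-suc-suc d a i)

shiftedBinomial-pascal : ∀ d a i →
  shiftedBinomial d (suc a) i ≡ shiftedBinomial d a i + shiftedBinomial (suc d) a i
shiftedBinomial-pascal d a zero    = sym (trans (cong (_+_ _) (shiftedBinomial-suc-zero d a)) (+-identityʳ _))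
shiftedBinomial-pascal d a (suc i) = cong (_+_ _) (sym (shiftedBinomial-suc-suc d a i))

-- For the rising and falling arc counts r, f of one pair of labels:
-- tᵈ (1 + t)ᵃ + tᵈ⁺¹ (1 + t)ᵃ = tᵈ (1 + t)ᵃ⁺¹.
pairing : ∀ {r f d d′} a i → r ≤ 1 → f ≤ 1 → (r ≢ 0 → f ≡ 0) → d′ + f ≡ d + r →
  (if f ≡ᵇ 0 then shiftedBinomial d a i else 0) + (if r ≡ᵇ 0 then 0 else shiftedBinomial d′ a i)
  ≡ (if f ≡ᵇ 0 then shiftedBinomial d (r + a) i else 0)
pairing {zero}        {zero}              a i _         _         _       _ = +-identityʳ _
pairing {zero}        {suc zero}          a i _         _         _       _ = refl
pairing {suc zero}    {zero}     {d} {d′} a i _         _         _       d′+0≡d+1 =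
  trans (cong (λ e → shiftedBinomial d a i + shiftedBinomial e a i) d′≡1+d) (sym (shiftedBinomial-pascal d a i))
  where d′≡1+d = trans (sym (+-identityʳ d′)) (trans d′+0≡d+1 (+-comm d 1))
pairing {suc zero}    {suc zero}          a i _         _         r≢0⇒f≡0 _ = contradiction (r≢0⇒f≡0 λ ()) λ ()
pairing {suc (suc r)}                     a i (s≤s ())  _         _       _
pairing {_}           {suc (suc f)}       a i _         (s≤s ())  _       _

tPow : ℕ → Poly
tPow zero    = + 1 ∷ []
tPow (suc d) = + 0 ∷ tPow d

coeff-tPow : ∀ d i → coeff (tPow d) i ≡ + shiftedBinomial d 0 i
coeff-tPow zero    zero    = refl
coeff-tPow zero    (suc i) = refl
coeff-tPow (suc d) zero    = refl
coeff-tPow (suc d) (suc i) = coeff-tPow d i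

coeff-tPlusOne^-*ₚ : ∀ {d b} q → (∀ i → coeff q i ≡ + shiftedBinomial d b i) →
                     ∀ k i → coeff ((tPlusOne ^ₚ k) *ₚ q) i ≡ + shiftedBinomial d (k + b) i
coeff-tPlusOne^-*ₚ q q≈ zero    i = trans (coeff-[1]-*ₚ q i) (q≈ i)
coeff-tPlusOne^-*ₚ {d} {b} q q≈ (suc k) i =
  trans (coeff-tPlusOne-*ₚ-*ₚ (tPlusOne ^ₚ k) q i) (pascal i)
  where
  IH = coeff-tPlusOne^-*ₚ q q≈ k
  pascal : ∀ i → coeff ((tPlusOne ^ₚ k) *ₚ q) i +ℤ coeff (+ 0 ∷ ((tPlusOne ^ₚ k) *ₚ q)) i
               ≡ + shiftedBinomial d (suc k + b) i
  pascal zero    = trans (ℤ.+-identityʳ _) (IH zero)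
  pascal (suc i) = cong₂ _+ℤ_ (IH (suc i)) (IH i)

sumₚ : List Poly → Poly
sumₚ = List.foldr _+ₚ_ []

coeff-*ₚ-sumₚ : ∀ {A : Set} p (f : A → Poly) (g : A → ℕ) xs i →
  (∀ x → coeff (p *ₚ f x) i ≡ + g x) → coeff (p *ₚ sumₚ (List.map f xs)) i ≡ + sum (List.map g xs)
coeff-*ₚ-sumₚ p f g []       i fg = coeff-*ₚ-[] p i
coeff-*ₚ-sumₚ p f g (x ∷ xs) i fg =
  trans (coeff-*ₚ-+ₚ p (f x) _ i) (cong₂ _+ℤ_ (fg x) (coeff-*ₚ-sumₚ p f g xs i fg))

coeff-map-applyUpTo : ∀ (f : ℕ → ℤ) g N i →
  coeff (List.map f (List.applyUpTo g N)) i ≡ (if i <ᵇ N then f (g i) else + 0)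
coeff-map-applyUpTo f g zero    i       = refl
coeff-map-applyUpTo f g (suc N) zero    = refl
coeff-map-applyUpTo f g (suc N) (suc i) = coeff-map-applyUpTo f (g ∘ suc) N i

-- Bijections and the adjacent transposition of values

andAll-∈ : ∀ {A : Set} (p : A → Bool) {xs x} → andAll p xs ≡ true → x ∈ xs → p x ≡ true
andAll-∈ p {y ∷ xs} all (here refl) = proj₁ (∧-≡true all)
andAll-∈ p {y ∷ xs} all (there x∈xs) = andAll-∈ p (proj₂ (∧-≡true {p y} all)) x∈xs

andAll-cong : ∀ {A : Set} {p q : A → Bool} → (∀ x → p x ≡ q x) → ∀ xs → andAll p xs ≡ andAll q xs
andAll-cong p≗q []       = refl
andAll-cong p≗q (x ∷ xs) = cong₂ _∧_ (p≗q x) (andAll-cong p≗q xs)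

isInjective⇒injective : ∀ {n} (σ : Vec (Fin n) n) → isInjective σ ≡ true → Injective _≡_ _≡_ (Vec.lookup σ)
isInjective⇒injective {n} σ inj {i} {j} σi≡σj
  with andAll-∈ _ (andAll-∈ _ inj (∈-allFin i)) (∈-allFin j)
... | σi≡σj⇒i≡j with Vec.lookup σ i Fin.≟ Vec.lookup σ j
...   | no σi≢σj = contradiction σi≡σj σi≢σj
...   | yes _ with i Fin.≟ j
...     | yes i≡j = i≡j

does-≟-injective : ∀ {m n} {f : Fin m → Fin n} → Injective _≡_ _≡_ f →
                   ∀ i j → does (f i Fin.≟ f j) ≡ does (i Fin.≟ j)
does-≟-injective {f = f} f-inj i j with i Fin.≟ j
... | yes refl = dec-true (f i Fin.≟ f i) refl
... | no i≢j   = dec-false (f i Fin.≟ f j) (i≢j ∘ f-inj)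

isInjective-map : ∀ {n} {f : Fin n → Fin n} → Injective _≡_ _≡_ f →
                  ∀ σ → isInjective (Vec.map f σ) ≡ isInjective σ
isInjective-map {n} {f} f-inj σ =
  andAll-cong (λ i → andAll-cong (λ j →
    cong (if_then does (i Fin.≟ j) else true)
      (trans (cong₂ (λ x y → does (x Fin.≟ y)) (Vec.lookup-map i f σ) (Vec.lookup-map j f σ))
             (does-≟-injective f-inj (Vec.lookup σ i) (Vec.lookup σ j)))) (allFin n)) (allFin n)

injective⇒surjective : ∀ {n} (f : Fin n → Fin n) → Injective _≡_ _≡_ f → ∀ y → ∃ λ x → f x ≡ y
injective⇒surjective {n} f f-inj y with Fin.any? (λ x → f x Fin.≟ y)
... | yes hit = hit
injective⇒surjective {suc n} f f-inj y | no miss =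
  contradiction (Fin.injective⇒≤ punchOut-inj) (<-irrefl refl)
  where
  f≢y : ∀ x → y ≢ f x
  f≢y x y≡fx = miss (x , sym y≡fx)
  punchOut-inj : Injective _≡_ _≡_ (λ x → Fin.punchOut (f≢y x))
  punchOut-inj {x} {x′} eq = f-inj (Fin.punchOut-injective (f≢y x) (f≢y x′) eq)

-- Exchanges the values q and q + 1; the identity when q + 1 ≥ n.
swapAdjacent : ∀ {n} → ℕ → Fin n → Fin n
swapAdjacent {suc (suc n)} zero    zero                = suc zero
swapAdjacent {suc (suc n)} zero    (suc zero)          = zero
swapAdjacent {suc (suc n)} zero    (suc (suc v))       = suc (suc v)
swapAdjacent {suc zero}    zero    zero                = zero
swapAdjacent               (suc q) zero                = zero
swapAdjacent               (suc q) (suc v)             = suc (swapAdjacent q v)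

swapAdjacent-involutive : ∀ {n} q (v : Fin n) → swapAdjacent q (swapAdjacent q v) ≡ v
swapAdjacent-involutive {suc (suc n)} zero    zero          = refl
swapAdjacent-involutive {suc (suc n)} zero    (suc zero)    = refl
swapAdjacent-involutive {suc (suc n)} zero    (suc (suc v)) = refl
swapAdjacent-involutive {suc zero}    zero    zero          = refl
swapAdjacent-involutive               (suc q) zero          = refl
swapAdjacent-involutive               (suc q) (suc v)       = cong suc (swapAdjacent-involutive q v)

swapAdjacentPermutation : ∀ {n} → ℕ → Permutation′ n
swapAdjacentPermutation q =
  permutation (swapAdjacent q) (swapAdjacent q) (swapAdjacent-involutive q) (swapAdjacent-involutive q)

swapAdjacent-≡ᵇ-lower : ∀ {n} q (v : Fin n) → suc q < n →
                        (toℕ (swapAdjacent q v) ≡ᵇ q) ≡ (toℕ v ≡ᵇ suc q)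
swapAdjacent-≡ᵇ-lower {suc (suc n)} zero    zero          _         = refl
swapAdjacent-≡ᵇ-lower {suc (suc n)} zero    (suc zero)    _         = refl
swapAdjacent-≡ᵇ-lower {suc (suc n)} zero    (suc (suc v)) _         = refl
swapAdjacent-≡ᵇ-lower {suc zero}    zero    zero          (s≤s ())
swapAdjacent-≡ᵇ-lower               (suc q) zero          _         = refl
swapAdjacent-≡ᵇ-lower {suc n}       (suc q) (suc v)       (s≤s q<n) = swapAdjacent-≡ᵇ-lower q v q<n

swapAdjacent-≡ᵇ-upper : ∀ {n} q (v : Fin n) → suc q < n →
                        (toℕ (swapAdjacent q v) ≡ᵇ suc q) ≡ (toℕ v ≡ᵇ q)
swapAdjacent-≡ᵇ-upper {suc (suc n)} zero    zero          _         = refl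
swapAdjacent-≡ᵇ-upper {suc (suc n)} zero    (suc zero)    _         = refl
swapAdjacent-≡ᵇ-upper {suc (suc n)} zero    (suc (suc v)) _         = refl
swapAdjacent-≡ᵇ-upper {suc zero}    zero    zero          (s≤s ())
swapAdjacent-≡ᵇ-upper               (suc q) zero          _         = refl
swapAdjacent-≡ᵇ-upper {suc n}       (suc q) (suc v)       (s≤s q<n) = swapAdjacent-≡ᵇ-upper q v q<n

swapAdjacent-≡ᵇ-other : ∀ {n} q r (v : Fin n) → r ≢ q → r ≢ suc q →
                        (toℕ (swapAdjacent q v) ≡ᵇ r) ≡ (toℕ v ≡ᵇ r)
swapAdjacent-≡ᵇ-other {suc (suc n)} zero    zero          zero          r≢q r≢q+1 = contradiction refl r≢q
swapAdjacent-≡ᵇ-other {suc (suc n)} zero    (suc zero)    zero          r≢q r≢q+1 = contradiction refl r≢q+1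
swapAdjacent-≡ᵇ-other {suc (suc n)} zero    (suc (suc r)) zero          r≢q r≢q+1 = refl
swapAdjacent-≡ᵇ-other {suc (suc n)} zero    zero          (suc zero)    r≢q r≢q+1 = contradiction refl r≢q
swapAdjacent-≡ᵇ-other {suc (suc n)} zero    (suc zero)    (suc zero)    r≢q r≢q+1 = contradiction refl r≢q+1
swapAdjacent-≡ᵇ-other {suc (suc n)} zero    (suc (suc r)) (suc zero)    r≢q r≢q+1 = refl
swapAdjacent-≡ᵇ-other {suc (suc n)} zero    r             (suc (suc v)) r≢q r≢q+1 = refl
swapAdjacent-≡ᵇ-other {suc zero}    zero    r             zero          r≢q r≢q+1 = refl
swapAdjacent-≡ᵇ-other               (suc q) r             zero          r≢q r≢q+1 = refl
swapAdjacent-≡ᵇ-other               (suc q) zero          (suc v)       r≢q r≢q+1 = refl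
swapAdjacent-≡ᵇ-other               (suc q) (suc r)       (suc v)       r≢q r≢q+1 =
  swapAdjacent-≡ᵇ-other q r v (r≢q ∘ cong suc) (r≢q+1 ∘ cong suc)

swapAdjacent-<ᵇ : ∀ {n} q (u v : Fin n) → suc q < n →
  indicator (toℕ (swapAdjacent q v) <ᵇ toℕ (swapAdjacent q u)) + indicator ((toℕ u ≡ᵇ suc q) ∧ (toℕ v ≡ᵇ q))
  ≡ indicator (toℕ v <ᵇ toℕ u) + indicator ((toℕ u ≡ᵇ q) ∧ (toℕ v ≡ᵇ suc q))
swapAdjacent-<ᵇ {suc (suc n)} zero    zero          zero          _ = refl
swapAdjacent-<ᵇ {suc (suc n)} zero    zero          (suc zero)    _ = refl
swapAdjacent-<ᵇ {suc (suc n)} zero    zero          (suc (suc v)) _ = refl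
swapAdjacent-<ᵇ {suc (suc n)} zero    (suc zero)    zero          _ = refl
swapAdjacent-<ᵇ {suc (suc n)} zero    (suc zero)    (suc zero)    _ = refl
swapAdjacent-<ᵇ {suc (suc n)} zero    (suc zero)    (suc (suc v)) _ = refl
swapAdjacent-<ᵇ {suc (suc n)} zero    (suc (suc u)) zero          _ = refl
swapAdjacent-<ᵇ {suc (suc n)} zero    (suc (suc u)) (suc zero)    _ = refl
swapAdjacent-<ᵇ {suc (suc n)} zero    (suc (suc u)) (suc (suc v)) _ = refl
swapAdjacent-<ᵇ {suc zero}    zero    zero          zero          (s≤s ())
swapAdjacent-<ᵇ               (suc q) zero          zero          _ = refl
swapAdjacent-<ᵇ               (suc q) zero          (suc v)       _ = refl
swapAdjacent-<ᵇ               (suc q) (suc u)       zero          _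
  with toℕ u ≡ᵇ suc q | toℕ u ≡ᵇ q
... | true  | true  = refl
... | true  | false = refl
... | false | true  = refl
... | false | false = refl
swapAdjacent-<ᵇ {suc n}       (suc q) (suc u)       (suc v)       (s≤s q<n) = swapAdjacent-<ᵇ q u v q<n

-- Labellings and their descents

module _ {n : ℕ} where

  label : Vec (Fin n) n → Fin n → ℕ
  label σ u = toℕ (Vec.lookup σ u)

  label-injective : ∀ σ → isInjective σ ≡ true → ∀ {u v} → label σ u ≡ label σ v → u ≡ v
  label-injective σ inj = isInjective⇒injective σ inj ∘ Fin.toℕ-injective

  swapLabels : ℕ → Vec (Fin n) n → Vec (Fin n) n
  swapLabels q = Vec.map (swapAdjacent q)

  label-swapLabels : ∀ q σ u → label (swapLabels q σ) u ≡ toℕ (swapAdjacent q (Vec.lookup σ u))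
  label-swapLabels q σ u = cong toℕ (Vec.lookup-map u (swapAdjacent q) σ)

  isInjective-swapLabels : ∀ q σ → isInjective (swapLabels q σ) ≡ isInjective σ
  isInjective-swapLabels q = isInjective-map λ {u} {v} eq →
    trans (sym (swapAdjacent-involutive q u)) (trans (cong (swapAdjacent q) eq) (swapAdjacent-involutive q v))

module _ {n : ℕ} (D : Rel n) where

  isLabelledArc : ℕ → ℕ → Vec (Fin n) n → Fin n → Fin n → Bool
  isLabelledArc x y σ u v = D u v ∧ ((label σ u ≡ᵇ x) ∧ (label σ v ≡ᵇ y))

  arcsLabelled : ℕ → ℕ → Vec (Fin n) n → ℕ
  arcsLabelled x y σ = countPairs (isLabelledArc x y σ)

  isDescent : Vec (Fin n) n → Fin n → Fin n → Bool
  isDescent σ u v = D u v ∧ (label σ v <ᵇ label σ u)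

  des≡countPairs : ∀ σ → des D σ ≡ countPairs (isDescent σ)
  des≡countPairs σ = trans (sum-map-allFin (λ u → count (isDescent σ u) (allFin n))) (sum-cong-≗ λ u →
    trans (count≡sum (isDescent σ u) (allFin n)) (sum-map-allFin (indicator ∘ isDescent σ u)))

  des-≤ : ∀ σ → des D σ ≤ n * n
  des-≤ σ = subst (_≤ n * n) (sym (des≡countPairs σ)) (countPairs-≤ (isDescent σ))

  labelledArc : ∀ x y σ {u v} → isLabelledArc x y σ u v ≡ true →
                D u v ≡ true × label σ u ≡ x × label σ v ≡ y
  labelledArc x y σ {u} {v} arc =
    let Duv , labels = ∧-≡true {D u v} arc
        ℓu≡x , ℓv≡y  = ∧-≡true labels
    in Duv , ≡ᵇ-sound ℓu≡x , ≡ᵇ-sound ℓv≡y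

  arcsLabelled≡0 : ∀ x y σ → arcsLabelled x y σ ≡ 0 →
                   ∀ {u v} → label σ u ≡ x → label σ v ≡ y → D u v ≡ false
  arcsLabelled≡0 x y σ none {u} {v} ℓu≡x ℓv≡y = begin
    D u v                    ≡⟨ ∧-identityʳ (D u v) ⟨
    D u v ∧ (true ∧ true)    ≡⟨ cong₂ (λ a b → D u v ∧ (a ∧ b)) (≡ᵇ-complete ℓu≡x) (≡ᵇ-complete ℓv≡y) ⟨
    isLabelledArc x y σ u v  ≡⟨ countPairs≡0⇒≡false _ none u v ⟩
    false                    ∎
    where open ≡-Reasoning

  arcsLabelled-≤1 : ∀ x y σ → isInjective σ ≡ true → arcsLabelled x y σ ≤ 1
  arcsLabelled-≤1 x y σ inj = countPairs-≤1 (isLabelledArc x y σ) λ arc arc′ →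
    let _ , ℓu≡x , ℓv≡y   = labelledArc x y σ arc
        _ , ℓu′≡x , ℓv′≡y = labelledArc x y σ arc′
    in label-injective σ inj (trans ℓu≡x (sym ℓu′≡x)) , label-injective σ inj (trans ℓv≡y (sym ℓv′≡y))

  arcsLabelled-antisym : (∀ u v → D u v ≡ true → ¬ (D v u ≡ true)) →
    ∀ x y σ → isInjective σ ≡ true → arcsLabelled x y σ ≢ 0 → arcsLabelled y x σ ≡ 0
  arcsLabelled-antisym antisym x y σ inj some with arcsLabelled y x σ ℕ.≟ 0
  ... | yes none = none
  ... | no some′ =
    let u  , v  , arc  = countPairs≢0⇒∃ (isLabelledArc x y σ) some
        u′ , v′ , arc′ = countPairs≢0⇒∃ (isLabelledArc y x σ) some′
        Duv   , ℓu≡x  , ℓv≡y  = labelledArc x y σ arc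
        Du′v′ , ℓu′≡y , ℓv′≡x = labelledArc y x σ arc′
        u≡v′ = label-injective σ inj (trans ℓu≡x (sym ℓv′≡x))
        v≡u′ = label-injective σ inj (trans ℓv≡y (sym ℓu′≡y))
    in contradiction (subst₂ (λ a b → D a b ≡ true) (sym v≡u′) (sym u≡v′) Du′v′) (antisym u v Duv)

  arcsLabelled-swapLabels-below : ∀ {q x y} σ → x < q → y < q →
                                  arcsLabelled x y (swapLabels q σ) ≡ arcsLabelled x y σ
  arcsLabelled-swapLabels-below {q} σ x<q y<q =
    countPairs-cong λ u v → cong (D u v ∧_) (cong₂ _∧_ (unchanged u x<q) (unchanged v y<q))
    where
    unchanged : ∀ w {z} → z < q → (label (swapLabels q σ) w ≡ᵇ z) ≡ (label σ w ≡ᵇ z)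
    unchanged w z<q = trans (cong (_≡ᵇ _) (label-swapLabels q σ w))
      (swapAdjacent-≡ᵇ-other q _ (Vec.lookup σ w) (<⇒≢ z<q) (<⇒≢ (m<n⇒m<1+n z<q)))

  arcsLabelled-swapLabels : ∀ {q} σ → suc q < n →
                            arcsLabelled (suc q) q (swapLabels q σ) ≡ arcsLabelled q (suc q) σ
  arcsLabelled-swapLabels {q} σ q+1<n = countPairs-cong λ u v → cong (D u v ∧_) (cong₂ _∧_
    (trans (cong (_≡ᵇ suc q) (label-swapLabels q σ u)) (swapAdjacent-≡ᵇ-upper q (Vec.lookup σ u) q+1<n))
    (trans (cong (_≡ᵇ q) (label-swapLabels q σ v)) (swapAdjacent-≡ᵇ-lower q (Vec.lookup σ v) q+1<n)))

  des-swapLabels : ∀ {q} σ → suc q < n →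
    des D (swapLabels q σ) + arcsLabelled (suc q) q σ ≡ des D σ + arcsLabelled q (suc q) σ
  des-swapLabels {q} σ q+1<n
    rewrite des≡countPairs (swapLabels q σ) | des≡countPairs σ = countPairs-+-cong λ u v → swapped (D u v) u v
    where
    swapped : ∀ b u v →
      indicator (b ∧ (label (swapLabels q σ) v <ᵇ label (swapLabels q σ) u))
        + indicator (b ∧ ((label σ u ≡ᵇ suc q) ∧ (label σ v ≡ᵇ q)))
      ≡ indicator (b ∧ (label σ v <ᵇ label σ u)) + indicator (b ∧ ((label σ u ≡ᵇ q) ∧ (label σ v ≡ᵇ suc q)))
    swapped false u v = refl
    swapped true  u v rewrite label-swapLabels q σ u | label-swapLabels q σ v =
      swapAdjacent-<ᵇ q (Vec.lookup σ u) (Vec.lookup σ v) q+1<n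

  rising falling : ℕ → Vec (Fin n) n → ℕ
  rising  p = arcsLabelled (p + p) (suc (p + p))
  falling p = arcsLabelled (suc (p + p)) (p + p)

  risingCount : ℕ → Vec (Fin n) n → ℕ
  risingCount zero    σ = 0
  risingCount (suc j) σ = rising j σ + risingCount j σ

  admissible : ℕ → Vec (Fin n) n → Bool
  admissible zero    σ = isInjective σ
  admissible (suc j) σ = admissible j σ ∧ (falling j σ ≡ᵇ 0)

  admissible⇒isInjective : ∀ j σ → admissible j σ ≡ true → isInjective σ ≡ true
  admissible⇒isInjective zero    σ adm = adm
  admissible⇒isInjective (suc j) σ adm = admissible⇒isInjective j σ (proj₁ (∧-≡true adm))

  rising-swapLabels : ∀ {p j} σ → p < j → rising p (swapLabels (j + j) σ) ≡ rising p σ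
  rising-swapLabels σ p<j = arcsLabelled-swapLabels-below σ (<-trans (n<1+n _) (double-< p<j)) (double-< p<j)

  falling-swapLabels : ∀ {p j} σ → p < j → falling p (swapLabels (j + j) σ) ≡ falling p σ
  falling-swapLabels σ p<j = arcsLabelled-swapLabels-below σ (double-< p<j) (<-trans (n<1+n _) (double-< p<j))

  risingCount-swapLabels : ∀ {j J} σ → j ≤ J → risingCount j (swapLabels (J + J) σ) ≡ risingCount j σ
  risingCount-swapLabels {zero}  σ j≤J = refl
  risingCount-swapLabels {suc j} σ j<J =
    cong₂ _+_ (rising-swapLabels σ j<J) (risingCount-swapLabels σ (<⇒≤ j<J))

  admissible-swapLabels : ∀ {j J} σ → j ≤ J → admissible j (swapLabels (J + J) σ) ≡ admissible j σ
  admissible-swapLabels {zero}  {J} σ j≤J = isInjective-swapLabels (J + J) σ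
  admissible-swapLabels {suc j}     σ j<J =
    cong₂ _∧_ (admissible-swapLabels σ (<⇒≤ j<J)) (cong (_≡ᵇ 0) (falling-swapLabels σ j<J))

  -- The coefficient of tⁱ in Σ t^(des σ) (1 + t)^(risingCount j σ) over the σ admissible for j;
  -- for j = 0 it is that of A_D(t).
  weight : ℕ → ℕ → Vec (Fin n) n → ℕ
  weight j i σ = if admissible j σ then shiftedBinomial (des D σ) (risingCount j σ) i else 0

  cofactor : ℕ → ℕ → Vec (Fin n) n → Poly
  cofactor k d σ = if admissible k σ then (tPlusOne ^ₚ (risingCount k σ ∸ d)) *ₚ tPow (des D σ) else []

  coeff-cofactor : ∀ {k d} i σ → (admissible k σ ≡ true → d ≤ risingCount k σ) →
                   coeff ((tPlusOne ^ₚ d) *ₚ cofactor k d σ) i ≡ + weight k i σ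
  coeff-cofactor {k} {d} i σ d≤r with admissible k σ
  ... | false = coeff-*ₚ-[] (tPlusOne ^ₚ d) i
  ... | true  = trans (coeff-tPlusOne^-*ₚ _ coeff-tPow^ d i)
                      (cong (λ e → + shiftedBinomial (des D σ) e i)
                            (trans (cong (_+_ d) (+-identityʳ _)) d+[r∸d]≡r))
    where
    coeff-tPow^ = coeff-tPlusOne^-*ₚ (tPow (des D σ)) (coeff-tPow (des D σ)) (risingCount k σ ∸ d)
    d+[r∸d]≡r = m+[n∸m]≡n (d≤r refl)

  module _ (antisym : ∀ u v → D u v ≡ true → ¬ (D v u ≡ true)) where

    sumVecs-weight-suc : ∀ j i → suc (j + j) < n → sumVecs n (weight j i) ≡ sumVecs n (weight (suc j) i)
    sumVecs-weight-suc j i 2j+1<n = begin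
      sumVecs n (weight j i)                                  ≡⟨ sumVecs-cong n split ⟩
      sumVecs n (λ σ → kept σ + moved σ)                      ≡⟨ sumVecs-distrib-+ n kept moved ⟩
      sumVecs n kept + sumVecs n moved
        ≡⟨ cong (_+_ _) (sumVecs-permute n (swapAdjacentPermutation (j + j)) moved) ⟨
      sumVecs n kept + sumVecs n (moved ∘ swapLabels (j + j))
        ≡⟨ sumVecs-distrib-+ n kept (moved ∘ swapLabels (j + j)) ⟨
      sumVecs n (λ σ → kept σ + moved (swapLabels (j + j) σ)) ≡⟨ sumVecs-cong n merge ⟩
      sumVecs n (weight (suc j) i)                            ∎
      where
      open ≡-Reasoning
      kept moved : Vec (Fin n) n → ℕ
      kept  σ = if falling j σ ≡ᵇ 0 then weight j i σ else 0
      moved σ = if falling j σ ≡ᵇ 0 then 0 else weight j i σ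

      split : ∀ σ → weight j i σ ≡ kept σ + moved σ
      split σ with falling j σ ≡ᵇ 0
      ... | true  = sym (+-identityʳ _)
      ... | false = refl

      merge : ∀ ρ → kept ρ + moved (swapLabels (j + j) ρ) ≡ weight (suc j) i ρ
      merge ρ rewrite arcsLabelled-swapLabels ρ 2j+1<n
                    | admissible-swapLabels ρ (≤-refl {j})
                    | risingCount-swapLabels ρ (≤-refl {j})
              with admissible j ρ in adm
      ... | false = cong₂ _+_ (if-0 (falling j ρ ≡ᵇ 0)) (if-0 (rising j ρ ≡ᵇ 0))
      ... | true  = pairing (risingCount j ρ) i (arcsLabelled-≤1 _ _ ρ inj) (arcsLabelled-≤1 _ _ ρ inj)
                      (arcsLabelled-antisym antisym _ _ ρ inj) (des-swapLabels ρ 2j+1<n)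
        where inj = admissible⇒isInjective j ρ adm

    sumVecs-weight : ∀ j i → j + j ≤ n → sumVecs n (weight 0 i) ≡ sumVecs n (weight j i)
    sumVecs-weight zero    i _      = refl
    sumVecs-weight (suc j) i 2j+2≤n =
      trans (sumVecs-weight j i (≤-trans (<⇒≤ (<-trans (n<1+n _) 2j+1<2j+2)) 2j+2≤n))
            (sumVecs-weight-suc j i (<-≤-trans 2j+1<2j+2 2j+2≤n))
      where 2j+1<2j+2 = double-< (n<1+n j)

  -- Matchings of the complement

  module _ {G : Rel n} (orientation : IsOrientation G D) (ρ : Vec (Fin n) n) (inj : isInjective ρ ≡ true) where
    open IsOrientation orientation

    labelled : ∀ x → x < n → ∃ λ u → label ρ u ≡ x
    labelled x x<n =
      let u , ρu≡x = injective⇒surjective (Vec.lookup ρ) (isInjective⇒injective ρ inj) (Fin.fromℕ< x<n)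
      in u , trans (cong toℕ ρu≡x) (Fin.toℕ-fromℕ< x<n)

    nonEdge : ∀ {x y} → arcsLabelled x y ρ ≡ 0 → arcsLabelled y x ρ ≡ 0 →
              ∀ {u v} → label ρ u ≡ x → label ρ v ≡ y → G u v ≡ false
    nonEdge {x} {y} none noneᵒᵖ {u} {v} ℓu≡x ℓv≡y with G u v in Guv
    ... | false = refl
    ... | true with edge⇒arc u v Guv
    ...   | inj₁ Duv = contradiction (trans (sym Duv) (arcsLabelled≡0 x y ρ none ℓu≡x ℓv≡y)) λ ()
    ...   | inj₂ Dvu = contradiction (trans (sym Dvu) (arcsLabelled≡0 y x ρ noneᵒᵖ ℓv≡y ℓu≡x)) λ ()

    record PartialMatching (j : ℕ) : Set where
      field
        pairs              : List (Fin n × Fin n)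
        isMatching         : IsComplementMatching G pairs
        length+risingCount : length pairs + risingCount j ρ ≡ j
        labels<            : All (λ u → label ρ u < j + j) (endpoints pairs)

    fresh : ∀ {u c} → label ρ u ≡ c → ∀ {es} → All (λ e → label ρ e < c) es → All (u ≢_) es
    fresh {c = c} ℓu≡c = All.map λ {e} ℓe<c u≡e →
      <-irrefl ℓu≡c (subst (λ w → label ρ w < c) (sym u≡e) ℓe<c)

    partialMatching : ∀ j → j + j ≤ n → admissible j ρ ≡ true → PartialMatching j
    partialMatching zero    _       _   = record
      { pairs = [] ; isMatching = record { nonEdge = [] ; disjoint = [] } ; length+risingCount = refl ; labels< = [] }
    partialMatching (suc j) 2j+2≤n adm = extend (rising j ρ ℕ.≟ 0)
      where
      2j+1<2j+2 = double-< (n<1+n j)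
      2j≤2j+2   = <⇒≤ (<-trans (n<1+n _) 2j+1<2j+2)
      2j+1<n    = <-≤-trans 2j+1<2j+2 2j+2≤n
      open PartialMatching (partialMatching j (≤-trans 2j≤2j+2 2j+2≤n) (proj₁ (∧-≡true adm)))

      extend : Dec (rising j ρ ≡ 0) → PartialMatching (suc j)
      extend (no some) = record
        { pairs              = pairs
        ; isMatching         = isMatching
        ; length+risingCount = trans (cong (λ r → length pairs + (r + risingCount j ρ)) rising≡1)
                                     (trans (+-suc _ _) (cong suc length+risingCount))
        ; labels<            = All.map (λ ℓ<2j → <-≤-trans ℓ<2j 2j≤2j+2) labels<
        }
        where rising≡1 = ≤-antisym (arcsLabelled-≤1 _ _ ρ inj) (n≢0⇒n>0 some)
      extend (yes none) = record
        { pairs              = (x , y) ∷ pairs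
        ; isMatching         = record
          { nonEdge  = (x≢y , nonEdge none falling≡0 ℓx≡2j ℓy≡2j+1) ∷ IsComplementMatching.nonEdge isMatching
          ; disjoint = (x≢y ∷ fresh ℓx≡2j labels<) ∷ fresh ℓy≡2j+1 (All.map m<n⇒m<1+n labels<)
                       ∷ IsComplementMatching.disjoint isMatching
          }
        ; length+risingCount = cong suc (trans (cong (λ r → length pairs + (r + risingCount j ρ)) none)
                                               length+risingCount)
        ; labels<            = subst (_< suc j + suc j) (sym ℓx≡2j) (<-trans (n<1+n _) 2j+1<2j+2)
                               ∷ subst (_< suc j + suc j) (sym ℓy≡2j+1) 2j+1<2j+2
                               ∷ All.map (λ ℓ<2j → <-≤-trans ℓ<2j 2j≤2j+2) labels<
        }
        where
        falling≡0 = ≡ᵇ-sound (proj₂ (∧-≡true {admissible j ρ} adm))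
        x = proj₁ (labelled (j + j) (<-trans (n<1+n _) 2j+1<n))
        ℓx≡2j = proj₂ (labelled (j + j) (<-trans (n<1+n _) 2j+1<n))
        y = proj₁ (labelled (suc (j + j)) 2j+1<n)
        ℓy≡2j+1 = proj₂ (labelled (suc (j + j)) 2j+1<n)
        x≢y : x ≢ y
        x≢y x≡y = <-irrefl (trans (sym ℓx≡2j) (trans (cong (label ρ) x≡y) ℓy≡2j+1)) (n<1+n _)

    risingCount-lowerBound : ∀ {k m} → k + k ≤ n → admissible k ρ ≡ true →
      ((M : List (Fin n × Fin n)) → IsComplementMatching G M → length M ≤ m) → k ∸ m ≤ risingCount k ρ
    risingCount-lowerBound {k} {m} 2k≤n adm maxMatching =
      subst (k ∸ m ≤_) (trans (cong (_∸ length pairs) (sym length+risingCount)) (m+n∸m≡n (length pairs) _))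
            (∸-monoʳ-≤ k (maxMatching pairs isMatching))
      where open PartialMatching (partialMatching k 2k≤n adm)

  count-bijections-des : ∀ i → count (λ σ → does (des D σ ℕ.≟ i)) (bijections n) ≡ sumVecs n (weight 0 i)
  count-bijections-des i = begin
    count (λ σ → des D σ ≡ᵇ i) (filterᵇ isInjective (allVecs n n))
      ≡⟨ count-filterᵇ _ isInjective (allVecs n n) ⟩
    count (λ σ → isInjective σ ∧ (des D σ ≡ᵇ i)) (allVecs n n)
      ≡⟨ count≡sum _ (allVecs n n) ⟩
    sum (List.map (λ σ → indicator (isInjective σ ∧ (des D σ ≡ᵇ i))) (allVecs n n))
      ≡⟨ sum-map-allVecs n _ ⟩
    sumVecs n (λ σ → indicator (isInjective σ ∧ (des D σ ≡ᵇ i)))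
      ≡⟨ sumVecs-cong n (λ σ → indicator-∧ (isInjective σ) _) ⟩
    sumVecs n (weight 0 i) ∎
    where open ≡-Reasoning

  coeff-A : ∀ i → coeff (A D) i ≡ + count (λ σ → does (des D σ ℕ.≟ i)) (bijections n)
  coeff-A i = trans (coeff-map-applyUpTo _ id (suc (n * n)) i) (inRange (i <ᵇ suc (n * n)) refl)
    where
    inRange : ∀ b → (i <ᵇ suc (n * n)) ≡ b →
      (if b then + count (λ σ → does (des D σ ℕ.≟ i)) (bijections n) else + 0)
      ≡ + count (λ σ → does (des D σ ℕ.≟ i)) (bijections n)
    inRange true  _        = refl
    inRange false i≮n*n+1 = cong +_ (sym (count-none _ (bijections n) λ σ →
      ≢⇒≡ᵇ≡false λ des≡i → <-irrefl des≡i (≤-<-trans (des-≤ σ) i>n*n)))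
      where
      i>n*n : n * n < i
      i>n*n = ≮⇒≥ λ i<n*n+1 → subst T i≮n*n+1 (<⇒<ᵇ i<n*n+1)

proposition1p8 : (n m : ℕ) (G D : Rel n) → IsSimpleGraph G → IsOrientation G D →
    ((M : List (Fin n × Fin n)) → IsComplementMatching G M → length M ≤ m) →
    RootMinusOneMultAtLeast (A D) ((n / 2) ∸ m)
proposition1p8 n m G D _ orientation maxMatching = quotient , coeffs
  where
  open IsOrientation orientation using (antisym)
  k = n / 2
  d = k ∸ m

  2k≤n : k + k ≤ n
  2k≤n = subst (_≤ n) (trans (*-comm k 2) (cong (_+_ k) (+-identityʳ k))) (m/n*n≤m n 2)

  d≤risingCount : ∀ σ → admissible D k σ ≡ true → d ≤ risingCount D k σ
  d≤risingCount σ adm =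
    risingCount-lowerBound D orientation σ (admissible⇒isInjective D k σ adm) 2k≤n adm maxMatching

  quotient : Poly
  quotient = sumₚ (List.map (cofactor D k d) (allVecs n n))

  coeffs : ∀ i → coeff (A D) i ≡ coeff ((tPlusOne ^ₚ d) *ₚ quotient) i
  coeffs i = begin
    coeff (A D) i                                         ≡⟨ coeff-A D i ⟩
    + count (λ σ → does (des D σ ℕ.≟ i)) (bijections n)   ≡⟨ cong +_ (count-bijections-des D i) ⟩
    + sumVecs n (weight D 0 i)                            ≡⟨ cong +_ (sumVecs-weight D antisym k i 2k≤n) ⟩
    + sumVecs n (weight D k i)                            ≡⟨ cong +_ (sum-map-allVecs n (weight D k i)) ⟨
    + sum (List.map (weight D k i) (allVecs n n))         ≡⟨ coeff-*ₚ-sumₚ (tPlusOne ^ₚ d) _ _ (allVecs n n) i cofactors ⟨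
    coeff ((tPlusOne ^ₚ d) *ₚ quotient) i                 ∎
    where
    open ≡-Reasoning
    cofactors : ∀ σ → coeff ((tPlusOne ^ₚ d) *ₚ cofactor D k d σ) i ≡ + weight D k i σ
    cofactors σ = coeff-cofactor D {k} {d} i σ (d≤risingCount σ)
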